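{- Let $k\ge 0$ be an integer and let $(a_n)_{n\ge0}$ be the $k$-shifted Catalan sequence, i.e. $a_n=0$ for $n<k$ and $a_n=C_{n-k}=\frac{1}{n-k+1}\binom{2(n-k)}{n-k}$ for $n\ge k$. Let $(b_n)_{n\ge0}$ be its Catalan transform, $b_n=\sum_{j=0}^{n}\frac{j}{2n-j}\binom{2n-j}{n-j}a_j$ (the coefficient being $1$ when $n=j=0$). Then $b_n=0$ for $n\le k-1$, $b_k=1$, and for $n\ge k+1$, $b_n$ equals the number of integer sequences $(u_1,\ldots,u_{n-k})$ satisfying $1\le u_i\le n$ for all $i$ and such that for all $1\le i<j\le n-k$, $u_j-(j-i)\notin[1,u_i-1]$.
   Context: $[a,b]$ denotes the set of integers $m$ with $a\le m\le b$ (empty if $b<a$). -}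

module Defs where

open import Data.Bool using (true; false)
open import Data.Nat as ℕ using (ℕ; zero; suc; _∸_; _≤ᵇ_)
open import Data.Nat.Combinatorics using (_C_)
open import Data.Integer as ℤ using (ℤ; +_)
open import Data.Rational as ℚ using (ℚ; _/_)
open import Data.Fin as Fin using (Fin; toℕ)
open import Data.Fin.Properties using (all?)
open import Data.Vec using (Vec; []; _∷_; lookup)
open import Data.List using (List; []; _∷_; applyUpTo; map; concatMap; filter; length; foldr; upTo)
open import Data.Product using (_×_)
open import Relation.Nullary using (¬_; Dec)
open import Relation.Nullary.Decidable using (_×-dec_; _→-dec_; ¬?)

catalan : ℕ → ℚ
catalan m = (+ ((2 ℕ.* m) C m)) / suc m

shiftedCatalan : ℕ → ℕ → ℚ
shiftedCatalan k n with k ≤ᵇ n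
... | true  = catalan (n ∸ k)
... | false = ℚ.0ℚ

-- Coefficient  j/(2n-j) * binom(2n-j, n-j)  (equal to 1 when n = j = 0,
-- which is the only case with 2n-j = 0 for j ≤ n).
transformCoeff : ℕ → ℕ → ℚ
transformCoeff n j with 2 ℕ.* n ∸ j
... | zero  = ℚ.1ℚ
... | suc d = (+ (j ℕ.* ((suc d) C (n ∸ j)))) / suc d

catalanTransform : (ℕ → ℚ) → ℕ → ℚ
catalanTransform a n =
  foldr ℚ._+_ ℚ.0ℚ (map (λ j → transformCoeff n j ℚ.* a j) (upTo (suc n)))

boundedSeqs : (n m : ℕ) → List (Vec ℕ m)
boundedSeqs n zero    = [] ∷ []
boundedSeqs n (suc m) =
  concatMap (λ x → map (x ∷_) (boundedSeqs n m)) (applyUpTo suc n)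

Valid : {m : ℕ} → Vec ℕ m → Set
Valid {m} u = (i j : Fin m) → i Fin.< j →
  ¬ ((ℤ.1ℤ ℤ.≤ v i j) × (v i j ℤ.≤ (+ lookup u i) ℤ.- ℤ.1ℤ))
  where
    v : Fin m → Fin m → ℤ
    v i j = (+ lookup u j) ℤ.- ((+ toℕ j) ℤ.- (+ toℕ i))

valid? : {m : ℕ} → (u : Vec ℕ m) → Dec (Valid u)
valid? {m} u = all? λ i → all? λ j →
  (i Fin.<? j) →-dec ¬? ((ℤ.1ℤ ℤ.≤? v i j) ×-dec (v i j ℤ.≤? (+ lookup u i) ℤ.- ℤ.1ℤ))
  where
    v : Fin m → Fin m → ℤ
    v i j = (+ lookup u j) ℤ.- ((+ toℕ j) ℤ.- (+ toℕ i))

countValid : (n m : ℕ) → ℕ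
countValid n m = length (filter valid? (boundedSeqs n m))

-- The coefficient j/(2n − j)·C(2n − j, n − j) is the ballot number T(n, n − j), so the transform
-- vanishes below k and equals B(n, n − k) = Σ_r T(n, r)·C_{n−k−r} from n = k on.
--
-- On the counting side, classify the valid sequences in a box by their last entry s + 1. If s is
-- at most the length of the prefix, the last s entries of the prefix form a block that is
-- independent of what precedes it and must lie below the staircase 1, 2, …, s; otherwise the
-- whole prefix lies below a shifted staircase. Applied to the square [1,n]^m and to the
-- staircases d+1, …, d+r this gives recursions for their counts G(n, m) and H(d, r). They force
-- H(d, r) = T(r + d + 1, r), so H(0, r) = C_r, and then give G the Pascal recursion
-- G(n+1, m+1) = G(n, m+1) + G(n+1, m) below the diagonal and a Catalan convolution on it.
-- B satisfies the same recursions, by the ballot recursion and Segner's recurrence.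

module Submission where

open import Defs
open import Data.Bool using (Bool; true; false; _∧_; _∨_; T; if_then_else_)
open import Data.Bool.Properties using (∧-assoc; ∧-comm; ∧-identityʳ; T-∧; T-∨)
open import Data.Fin as Fin using (Fin; toℕ)
open import Data.Integer as ℤ using (+_; _⊖_; 1ℤ)
open import Data.Integer.Properties as ℤ using ()
open import Data.List
  using (List; []; _∷_; _++_; [_]; length; replicate; map; foldr; applyUpTo; concatMap; filter)
open import Data.List.Properties using (++-assoc; length-replicate)
open import Data.List.Relation.Binary.Pointwise using (Pointwise; []; _∷_)
open import Data.Nat
  using (ℕ; zero; suc; _+_; _*_; _∸_; _≤_; _<_; z≤n; s≤s; s≤s⁻¹; z<s; _≤ᵇ_; _<ᵇ_; _≤?_)
open import Data.Nat.Combinatorics using (_C_; nCk+nC[k+1]≡[n+1]C[k+1]; nC1≡n; nCk≡nC[n∸k])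
open import Data.Nat.Coprimality using (1-coprimeTo) renaming (sym to coprime-sym)
open import Data.Nat.Induction using (<-rec)
open import Data.Nat.Properties
open import Algebra.Properties.CommutativeSemigroup +-commutativeSemigroup
  using (interchange; xy∙z≈xz∙y)
open import Data.Nat.Solver using (module +-*-Solver)
open import Data.Product using (_×_; _,_; proj₁; proj₂)
open import Data.Rational as ℚ using (ℚ; mkℚ; _/_; 0ℚ; 1ℚ)
open import Data.Rational.Properties as ℚ using ()
open import Data.Rational.Unnormalised using (mkℚᵘ; *≡*)
open import Data.Sum using (inj₁; inj₂; [_,_]′)
open import Data.Unit using (tt)
open import Data.Vec using (Vec; lookup; toList) renaming (_∷_ to _∷ᵛ_; [] to []ᵛ)
open import Function.Bundles using (_⇔_; mk⇔; Equivalence)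
open import Relation.Binary.PropositionalEquality hiding ([_])
open import Relation.Nullary using (¬_; Dec; yes; no; does; contradiction)
open import Relation.Nullary.Decidable using (does-⇔; T?)

open ≡-Reasoning

≤⇒≤ᵇ≡true : ∀ {m n} → m ≤ n → (m ≤ᵇ n) ≡ true
≤⇒≤ᵇ≡true {m} {n} m≤n with m ≤ᵇ n | ≤⇒≤ᵇ m≤n
... | true | _ = refl

>⇒≤ᵇ≡false : ∀ {m n} → n < m → (m ≤ᵇ n) ≡ false
>⇒≤ᵇ≡false {m} {n} n<m with m ≤ᵇ n in eq
... | false = refl
... | true  = contradiction (≤ᵇ⇒≤ m n (subst T (sym eq) tt)) (<⇒≱ n<m)

-- Finite sums

∑ : ℕ → (ℕ → ℕ) → ℕ
∑ zero    f = 0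
∑ (suc n) f = f 0 + ∑ n (λ i → f (suc i))

infixl 10 ∑
syntax ∑ n (λ i → e) = ∑[ i < n ] e

∑-cong : ∀ n {f g : ℕ → ℕ} → (∀ i → i < n → f i ≡ g i) → ∑ n f ≡ ∑ n g
∑-cong zero    f≗g = refl
∑-cong (suc n) f≗g = cong₂ _+_ (f≗g 0 z<s) (∑-cong n (λ i i<n → f≗g (suc i) (s≤s i<n)))

∑-zero : ∀ n (f : ℕ → ℕ) → (∀ i → i < n → f i ≡ 0) → ∑ n f ≡ 0
∑-zero zero    f f≗0 = refl
∑-zero (suc n) f f≗0 =
  cong₂ _+_ (f≗0 0 z<s) (∑-zero n (λ i → f (suc i)) (λ i i<n → f≗0 (suc i) (s≤s i<n)))

∑-distrib-+ : ∀ n (f g : ℕ → ℕ) → ∑[ i < n ] (f i + g i) ≡ ∑ n f + ∑ n g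
∑-distrib-+ zero    f g = refl
∑-distrib-+ (suc n) f g = begin
  (f 0 + g 0) + ∑[ i < n ] (f (suc i) + g (suc i))
    ≡⟨ cong (_+_ (f 0 + g 0)) (∑-distrib-+ n (λ i → f (suc i)) (λ i → g (suc i))) ⟩
  (f 0 + g 0) + (∑[ i < n ] f (suc i) + ∑[ i < n ] g (suc i))
    ≡⟨ interchange (f 0) (g 0) _ _ ⟩
  (f 0 + ∑[ i < n ] f (suc i)) + (g 0 + ∑[ i < n ] g (suc i)) ∎

*-distribˡ-∑ : ∀ n c (f : ℕ → ℕ) → c * ∑ n f ≡ ∑[ i < n ] (c * f i)
*-distribˡ-∑ zero    c f = *-zeroʳ c
*-distribˡ-∑ (suc n) c f =
  trans (*-distribˡ-+ c (f 0) _) (cong (_+_ (c * f 0)) (*-distribˡ-∑ n c (λ i → f (suc i))))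

*-distribʳ-∑ : ∀ n c (f : ℕ → ℕ) → ∑ n f * c ≡ ∑[ i < n ] (f i * c)
*-distribʳ-∑ n c f = begin
  ∑ n f * c           ≡⟨ *-comm (∑ n f) c ⟩
  c * ∑ n f           ≡⟨ *-distribˡ-∑ n c f ⟩
  ∑[ i < n ] (c * f i)  ≡⟨ ∑-cong n (λ i _ → *-comm c (f i)) ⟩
  ∑[ i < n ] (f i * c)  ∎

∑-split : ∀ a b (f : ℕ → ℕ) → ∑ (a + b) f ≡ ∑ a f + ∑[ i < b ] f (a + i)
∑-split zero    b f = refl
∑-split (suc a) b f =
  trans (cong (_+_ (f 0)) (∑-split a b (λ i → f (suc i)))) (sym (+-assoc (f 0) _ _))

∑-last : ∀ n (f : ℕ → ℕ) → ∑ (suc n) f ≡ ∑ n f + f n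
∑-last n f = begin
  ∑ (suc n) f                   ≡⟨ cong (λ m → ∑ m f) (+-comm 1 n) ⟩
  ∑ (n + 1) f                   ≡⟨ ∑-split n 1 f ⟩
  ∑ n f + (f (n + 0) + 0)       ≡⟨ cong (_+_ (∑ n f)) (trans (+-identityʳ _) (cong f (+-identityʳ n))) ⟩
  ∑ n f + f n                   ∎

∑-truncate : ∀ k b (f : ℕ → ℕ) → k ≤ b → (∀ i → k ≤ i → i < b → f i ≡ 0) → ∑ b f ≡ ∑ k f
∑-truncate k b f k≤b f≗0 = begin
  ∑ b f                                     ≡⟨ cong (λ m → ∑ m f) (sym (m+[n∸m]≡n k≤b)) ⟩
  ∑ (k + (b ∸ k)) f                         ≡⟨ ∑-split k (b ∸ k) f ⟩
  ∑ k f + ∑[ i < b ∸ k ] f (k + i)          ≡⟨ cong (_+_ (∑ k f)) (∑-zero (b ∸ k) _ tail≗0) ⟩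
  ∑ k f + 0                                 ≡⟨ +-identityʳ _ ⟩
  ∑ k f                                     ∎
  where
  tail≗0 : ∀ i → i < b ∸ k → f (k + i) ≡ 0
  tail≗0 i i<b∸k = f≗0 (k + i) (m≤m+n k i) (subst (k + i <_) (m+[n∸m]≡n k≤b) (+-monoʳ-< k i<b∸k))

∑-comm : ∀ a b (f : ℕ → ℕ → ℕ) → ∑[ i < a ] ∑[ j < b ] f i j ≡ ∑[ j < b ] ∑[ i < a ] f i j
∑-comm zero    b f = sym (∑-zero b _ (λ _ _ → refl))
∑-comm (suc a) b f = begin
  ∑[ j < b ] f 0 j + ∑[ i < a ] ∑[ j < b ] f (suc i) j
    ≡⟨ cong (_+_ (∑[ j < b ] f 0 j)) (∑-comm a b (λ i j → f (suc i) j)) ⟩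
  ∑[ j < b ] f 0 j + ∑[ j < b ] ∑[ i < a ] f (suc i) j
    ≡⟨ sym (∑-distrib-+ b (λ j → f 0 j) (λ j → ∑[ i < a ] f (suc i) j)) ⟩
  ∑[ j < b ] ∑[ i < suc a ] f i j ∎

∑-reverse : ∀ n (f : ℕ → ℕ) → ∑ n f ≡ ∑[ i < n ] f (n ∸ suc i)
∑-reverse zero    f = refl
∑-reverse (suc n) f = begin
  f 0 + ∑[ i < n ] f (suc i)
    ≡⟨ cong (_+_ (f 0)) (∑-reverse n (λ i → f (suc i))) ⟩
  f 0 + ∑[ i < n ] f (suc (n ∸ suc i))
    ≡⟨ +-comm (f 0) _ ⟩
  ∑[ i < n ] f (suc (n ∸ suc i)) + f 0
    ≡⟨ cong₂ _+_ (∑-cong n (λ i i<n → cong f (sym (+-∸-assoc 1 i<n)))) (cong f (sym (n∸n≡0 n))) ⟩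
  ∑[ i < n ] f (suc n ∸ suc i) + f (suc n ∸ suc n)
    ≡⟨ sym (∑-last n (λ i → f (suc n ∸ suc i))) ⟩
  ∑[ i < suc n ] f (suc n ∸ suc i) ∎

-- Both sides sum F r s over the triangle r + s ≤ N; each is turned into a square sum
-- whose summand vanishes off the triangle.
∑-triangle : ∀ N (F : ℕ → ℕ → ℕ) →
  ∑[ s < suc N ] ∑[ r < suc (N ∸ s) ] F r s ≡ ∑[ r < suc N ] ∑[ s < suc (N ∸ r) ] F r s
∑-triangle N F = begin
  ∑[ s < suc N ] ∑[ r < suc (N ∸ s) ] F r s
    ≡⟨ ∑-cong (suc N) (λ s s≤N → toSquare s (λ r → F r s) (s≤s⁻¹ s≤N)) ⟩
  ∑[ s < suc N ] ∑[ r < suc N ] (if r + s ≤ᵇ N then F r s else 0)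
    ≡⟨ ∑-comm (suc N) (suc N) (λ s r → if r + s ≤ᵇ N then F r s else 0) ⟩
  ∑[ r < suc N ] ∑[ s < suc N ] (if r + s ≤ᵇ N then F r s else 0)
    ≡⟨ ∑-cong (suc N) (λ r _ → ∑-cong (suc N) (λ s _ →
         cong (λ t → if t ≤ᵇ N then F r s else 0) (+-comm r s))) ⟩
  ∑[ r < suc N ] ∑[ s < suc N ] (if s + r ≤ᵇ N then F r s else 0)
    ≡⟨ sym (∑-cong (suc N) (λ r r≤N → toSquare r (F r) (s≤s⁻¹ r≤N))) ⟩
  ∑[ r < suc N ] ∑[ s < suc (N ∸ r) ] F r s ∎
  where
  toSquare : ∀ s (g : ℕ → ℕ) → s ≤ N →
    ∑ (suc (N ∸ s)) g ≡ ∑[ r < suc N ] (if r + s ≤ᵇ N then g r else 0)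
  toSquare s g s≤N = sym (trans
    (∑-truncate (suc (N ∸ s)) (suc N) _ (s≤s (m∸n≤m N s)) (λ r N∸s<r _ →
      cong (λ b → if b then g r else 0)
           (>⇒≤ᵇ≡false (subst (_< r + s) (m∸n+n≡m s≤N) (+-monoˡ-< s N∸s<r)))))
    (∑-cong (suc (N ∸ s)) (λ r r≤N∸s →
      cong (λ b → if b then g r else 0)
           (≤⇒≤ᵇ≡true (subst (r + s ≤_) (m∸n+n≡m s≤N) (+-monoˡ-≤ s (s≤s⁻¹ r≤N∸s)))))))

-- Ballot and Catalan numbers

-- Lattice paths from (0,0) to (n,r) that stay strictly below the diagonal after leaving the origin.
ballot : ℕ → ℕ → ℕ
ballot n       zero    = 1
ballot zero    (suc r) = 0
ballot (suc n) (suc r) = if r <ᵇ n then ballot n (suc r) + ballot (suc n) r else 0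

catalanℕ : ℕ → ℕ
catalanℕ m = ballot (suc m) m

ballot-step : ∀ n r → r < n → ballot (suc n) (suc r) ≡ ballot n (suc r) + ballot (suc n) r
ballot-step n r r<n with r <ᵇ n | <⇒<ᵇ r<n
... | true | _ = refl

ballot-diagonal : ∀ n → ballot (suc n) (suc n) ≡ 0
ballot-diagonal n with n <ᵇ n in eq
... | false = refl
... | true  = contradiction (<ᵇ⇒< n n (subst T (sym eq) tt)) (n≮n n)

ballot-unroll : ∀ r d → ballot (suc (suc (r + d))) (suc r) ≡ ∑[ e < suc d ] ballot (suc (r + suc e)) r
ballot-unroll r zero = begin
  ballot (suc (suc (r + 0))) (suc r)
    ≡⟨ ballot-step (suc (r + 0)) r (s≤s (≤-reflexive (sym (+-identityʳ r)))) ⟩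
  ballot (suc (r + 0)) (suc r) + ballot (suc (suc (r + 0))) r
    ≡⟨ cong₂ _+_ (trans (cong (λ t → ballot (suc t) (suc r)) (+-identityʳ r)) (ballot-diagonal r))
                 (cong (λ t → ballot (suc t) r) (sym (+-suc r 0))) ⟩
  0 + ballot (suc (r + 1)) r
    ≡⟨ +-comm 0 _ ⟩
  ballot (suc (r + 1)) r + 0 ∎
ballot-unroll r (suc d) = begin
  ballot (suc (suc (r + suc d))) (suc r)
    ≡⟨ ballot-step (suc (r + suc d)) r (s≤s (m≤m+n r (suc d))) ⟩
  ballot (suc (r + suc d)) (suc r) + ballot (suc (suc (r + suc d))) r
    ≡⟨ cong₂ _+_ (trans (cong (λ t → ballot (suc t) (suc r)) (+-suc r d)) (ballot-unroll r d))
                 (cong (λ t → ballot (suc t) r) (sym (+-suc r (suc d)))) ⟩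
  ∑[ e < suc d ] ballot (suc (r + suc e)) r + ballot (suc (r + suc (suc d))) r
    ≡⟨ sym (∑-last (suc d) (λ e → ballot (suc (r + suc e)) r)) ⟩
  ∑[ e < suc (suc d) ] ballot (suc (r + suc e)) r ∎

[1+k]*[1+n]C[1+k]≡[1+n]*nCk : ∀ n k → suc k * (suc n C suc k) ≡ suc n * (n C k)
[1+k]*[1+n]C[1+k]≡[1+n]*nCk zero    zero    = refl
[1+k]*[1+n]C[1+k]≡[1+n]*nCk zero    (suc k) = *-zeroʳ (suc (suc k))
[1+k]*[1+n]C[1+k]≡[1+n]*nCk (suc n) zero    = begin
  suc (suc n) C 1 + 0     ≡⟨ +-identityʳ _ ⟩
  suc (suc n) C 1         ≡⟨ nC1≡n (suc (suc n)) ⟩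
  suc (suc n)             ≡⟨ sym (*-identityʳ _) ⟩
  suc (suc n) * 1         ∎
[1+k]*[1+n]C[1+k]≡[1+n]*nCk (suc n) (suc k) = begin
  suc (suc k) * (suc (suc n) C suc (suc k))
    ≡⟨ cong (suc (suc k) *_) (sym (nCk+nC[k+1]≡[n+1]C[k+1] (suc n) (suc k))) ⟩
  suc (suc k) * (X + Y)
    ≡⟨ solve 3 (λ k x y → (con 1 :+ k) :* (x :+ y) := (k :* x :+ x) :+ (con 1 :+ k) :* y) refl (suc k) X Y ⟩
  (suc k * X + X) + suc (suc k) * Y
    ≡⟨ cong₂ (λ a b → (a + X) + b) ([1+k]*[1+n]C[1+k]≡[1+n]*nCk n k) ([1+k]*[1+n]C[1+k]≡[1+n]*nCk n (suc k)) ⟩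
  (suc n * (n C k) + X) + suc n * (n C suc k)
    ≡⟨ solve 4 (λ s a x b → (s :* a :+ x) :+ s :* b := s :* (a :+ b) :+ x) refl (suc n) (n C k) X (n C suc k) ⟩
  suc n * (n C k + n C suc k) + X
    ≡⟨ cong (λ z → suc n * z + X) (nCk+nC[k+1]≡[n+1]C[k+1] n k) ⟩
  suc n * X + X
    ≡⟨ +-comm (suc n * X) X ⟩
  suc (suc n) * X ∎
  where
  open +-*-Solver
  X = suc n C suc k
  Y = suc n C suc (suc k)

ballot-closed : ∀ n r → r ≤ n → ballot n r * (n + r) ≡ (n ∸ r) * ((n + r) C r)
ballot-closed n       zero    _         = trans (+-identityʳ (n + 0)) (trans (+-identityʳ n) (sym (*-identityʳ n)))
ballot-closed (suc n) (suc r) (s≤s r≤n) with m≤n⇒m<n∨m≡n r≤n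
... | inj₂ refl = trans (cong (_* (suc n + suc n)) (ballot-diagonal n))
                       (cong (_* ((suc n + suc n) C suc n)) (sym (n∸n≡0 n)))
... | inj₁ r<n  = step (n ∸ suc r) (m+[n∸m]≡n r<n)
                       (ballot-closed n (suc r) r<n) (ballot-closed (suc n) r (m≤n⇒m≤1+n r≤n))
  where
  step : ∀ {n} q → suc r + q ≡ n →
    ballot n (suc r) * (n + suc r) ≡ (n ∸ suc r) * ((n + suc r) C suc r) →
    ballot (suc n) r * (suc n + r) ≡ (suc n ∸ r) * ((suc n + r) C r) →
    ballot (suc n) (suc r) * (suc n + suc r) ≡ (suc n ∸ suc r) * ((suc n + suc r) C suc r)
  -- Multiplied by N, the step is a polynomial identity given the two induction hypotheses and
  -- absorption (r + 1)(A + B) = (N + 1) A, where A = C(N, r), B = C(N, r + 1), N = n + r + 1.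
  step {n} q refl ih₁ ih₂ = begin
    ballot (suc n) (suc r) * suc N  ≡⟨ cong (_* suc N) (ballot-step n r (s≤s (m≤m+n r q))) ⟩
    (x + y) * suc N                 ≡⟨ *-cancelˡ-≡ _ _ N cleared ⟩
    suc q * (A + B)                 ≡⟨ cong₂ _*_ (sym n+1∸r+1≡q+1) (nCk+nC[k+1]≡[n+1]C[k+1] N r) ⟩
    (suc n ∸ suc r) * (suc N C suc r) ∎
    where
    open +-*-Solver
    N = n + suc r
    x = ballot n (suc r)
    y = ballot (suc n) r
    A = N C r
    B = N C suc r
    n+1∸r+1≡q+1 : suc n ∸ suc r ≡ suc q
    n+1∸r+1≡q+1 = trans (+-∸-assoc 1 (m≤m+n r q)) (cong suc (m+n∸m≡n r q))
    xN : x * N ≡ q * B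
    xN = trans ih₁ (cong (_* B) (m+n∸m≡n (suc r) q))
    yN : y * N ≡ (q + 2) * A
    yN = begin
      y * N                          ≡⟨ cong (y *_) (+-suc n r) ⟩
      y * (suc n + r)                ≡⟨ ih₂ ⟩
      (suc n ∸ r) * ((suc n + r) C r) ≡⟨ cong₂ (λ a b → a * (b C r)) n+1∸r≡q+2 (sym (+-suc n r)) ⟩
      (q + 2) * A                    ∎
      where
      n+1∸r≡q+2 : suc n ∸ r ≡ q + 2
      n+1∸r≡q+2 = trans (+-∸-assoc 2 (m≤m+n r q)) (trans (cong (_+_ 2) (m+n∸m≡n r q)) (+-comm 2 q))
    absorb : suc r * (A + B) ≡ suc N * A
    absorb = trans (cong (suc r *_) (nCk+nC[k+1]≡[n+1]C[k+1] N r)) ([1+k]*[1+n]C[1+k]≡[1+n]*nCk N r)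
    polynomial : suc N * (q * B + (q + 2) * A) + 2 * (suc r * (A + B)) ≡ N * (suc q * (A + B)) + 2 * (suc N * A)
    polynomial = solve 4 (λ r q A B → let N = (con 1 :+ r) :+ q :+ (con 1 :+ r) in
         (con 1 :+ N) :* (q :* B :+ (q :+ con 2) :* A) :+ con 2 :* ((con 1 :+ r) :* (A :+ B))
      := N :* ((con 1 :+ q) :* (A :+ B)) :+ con 2 :* ((con 1 :+ N) :* A))
      refl r q A B
    cleared : N * ((x + y) * suc N) ≡ N * (suc q * (A + B))
    cleared = begin
      N * ((x + y) * suc N)
        ≡⟨ solve 4 (λ n x y m → n :* ((x :+ y) :* m) := m :* (x :* n :+ y :* n)) refl N x y (suc N) ⟩
      suc N * (x * N + y * N)
        ≡⟨ cong₂ (λ a b → suc N * (a + b)) xN yN ⟩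
      suc N * (q * B + (q + 2) * A)
        ≡⟨ +-cancelʳ-≡ _ _ _ (trans (cong (λ t → suc N * (q * B + (q + 2) * A) + 2 * t) (sym absorb)) polynomial) ⟩
      N * (suc q * (A + B)) ∎

catalanℕ-closed : ∀ m → (2 * m) C m ≡ catalanℕ m * suc m
catalanℕ-closed m = *-cancelˡ-≡ _ _ (suc K) (begin
  suc K * ((2 * m) C m)
    ≡⟨ cong (λ t → suc K * ((m + t) C m)) (+-identityʳ m) ⟩
  suc K * (K C m)
    ≡⟨ sym ([1+k]*[1+n]C[1+k]≡[1+n]*nCk K m) ⟩
  suc m * (suc K C suc m)
    ≡⟨ cong (suc m *_) (sym symmetric) ⟩
  suc m * (suc K C m)
    ≡⟨ cong (suc m *_) (sym closed) ⟩
  suc m * (catalanℕ m * suc K)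
    ≡⟨ solve 3 (λ a c k → a :* (c :* k) := k :* (c :* a)) refl (suc m) (catalanℕ m) (suc K) ⟩
  suc K * (catalanℕ m * suc m) ∎)
  where
  open +-*-Solver
  K = m + m
  closed : catalanℕ m * suc K ≡ suc K C m
  closed = begin
    catalanℕ m * suc K
      ≡⟨ ballot-closed (suc m) m (n≤1+n m) ⟩
    (suc m ∸ m) * (suc K C m)
      ≡⟨ cong (_* (suc K C m)) (trans (+-∸-assoc 1 (≤-refl {m})) (cong suc (n∸n≡0 m))) ⟩
    1 * (suc K C m)
      ≡⟨ *-identityˡ _ ⟩
    suc K C m ∎
  symmetric : suc K C m ≡ suc K C suc m
  symmetric = trans (nCk≡nC[n∸k] (≤-trans (m≤m+n m m) (n≤1+n K)))
                    (cong (suc K C_) (trans (+-∸-assoc 1 (m≤m+n m m)) (cong suc (m+n∸m≡n m m))))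

ballotConvolution : ℕ → ℕ → ℕ
ballotConvolution n m = ∑[ r < suc m ] (ballot n r * catalanℕ (m ∸ r))

-- Valid lists

T-injective : ∀ {b c} → (T b → T c) → (T c → T b) → b ≡ c
T-injective {false} {false} _ _ = refl
T-injective {false} {true}  _ c⇒b = contradiction (c⇒b _) λ ()
T-injective {true}  {false} b⇒c _ = contradiction (b⇒c _) λ ()
T-injective {true}  {true}  _ _ = refl

-- compatible x δ y: an entry y placed δ positions after an entry x is allowed,
-- i.e. y − δ ∉ [1, x − 1].
compatible : ℕ → ℕ → ℕ → Bool
compatible x δ y = (δ + x ≤ᵇ y) ∨ (y ≤ᵇ δ)

compatibleWithAll : ℕ → ℕ → List ℕ → Bool
compatibleWithAll x δ []       = true
compatibleWithAll x δ (y ∷ ys) = compatible x δ y ∧ compatibleWithAll x (suc δ) ys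

validList : List ℕ → Bool
validList []       = true
validList (x ∷ xs) = compatibleWithAll x 1 xs ∧ validList xs

compatibleAcross : List ℕ → List ℕ → Bool
compatibleAcross []      v = true
compatibleAcross (x ∷ u) v = compatibleWithAll x (suc (length u)) v ∧ compatibleAcross u v

belowStaircase : ℕ → List ℕ → Bool
belowStaircase k []      = true
belowStaircase k (x ∷ q) = (x ≤ᵇ k) ∧ belowStaircase (suc k) q

compatible-near : ∀ x {δ y} → y ≤ δ → T (compatible x δ y)
compatible-near x y≤δ = Equivalence.from T-∨ (inj₂ (≤⇒≤ᵇ y≤δ))

compatible-far : ∀ x δ k → compatible x δ (δ + suc k) ≡ (x ≤ᵇ suc k)
compatible-far x δ k = T-injective to from
  where
  to : T (compatible x δ (δ + suc k)) → T (x ≤ᵇ suc k)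
  to t with Equivalence.to T-∨ t
  ... | inj₁ t₁ = ≤⇒≤ᵇ (+-cancelˡ-≤ δ x (suc k) (≤ᵇ⇒≤ _ _ t₁))
  ... | inj₂ t₂ = contradiction (≤ᵇ⇒≤ _ _ t₂) (<⇒≱ (m<m+n δ z<s))
  from : T (x ≤ᵇ suc k) → T (compatible x δ (δ + suc k))
  from t = Equivalence.from T-∨ (inj₁ (≤⇒≤ᵇ (+-monoʳ-≤ δ (≤ᵇ⇒≤ _ _ t))))

compatibleWithAll-++ : ∀ x δ u v →
  compatibleWithAll x δ (u ++ v) ≡ compatibleWithAll x δ u ∧ compatibleWithAll x (δ + length u) v
compatibleWithAll-++ x δ []      v = cong (λ d → compatibleWithAll x d v) (sym (+-identityʳ δ))
compatibleWithAll-++ x δ (y ∷ u) v = begin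
  compatible x δ y ∧ compatibleWithAll x (suc δ) (u ++ v)
    ≡⟨ cong (compatible x δ y ∧_) (compatibleWithAll-++ x (suc δ) u v) ⟩
  compatible x δ y ∧ (compatibleWithAll x (suc δ) u ∧ compatibleWithAll x (suc δ + length u) v)
    ≡⟨ sym (∧-assoc (compatible x δ y) _ _) ⟩
  (compatible x δ y ∧ compatibleWithAll x (suc δ) u) ∧ compatibleWithAll x (suc δ + length u) v
    ≡⟨ cong (λ d → (compatible x δ y ∧ compatibleWithAll x (suc δ) u) ∧ compatibleWithAll x d v)
            (sym (+-suc δ (length u))) ⟩
  (compatible x δ y ∧ compatibleWithAll x (suc δ) u) ∧ compatibleWithAll x (δ + suc (length u)) v ∎

validList-++ : ∀ u v → validList (u ++ v) ≡ validList u ∧ (validList v ∧ compatibleAcross u v)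
validList-++ []      v = sym (∧-identityʳ (validList v))
validList-++ (x ∷ u) v = begin
  compatibleWithAll x 1 (u ++ v) ∧ validList (u ++ v)
    ≡⟨ cong₂ _∧_ (compatibleWithAll-++ x 1 u v) (validList-++ u v) ⟩
  (a ∧ b) ∧ (validList u ∧ (validList v ∧ compatibleAcross u v))
    ≡⟨ shuffle a b (validList u) (validList v) (compatibleAcross u v) ⟩
  (a ∧ validList u) ∧ (validList v ∧ (b ∧ compatibleAcross u v)) ∎
  where
  a = compatibleWithAll x 1 u
  b = compatibleWithAll x (suc (length u)) v
  shuffle : ∀ a b c d e → (a ∧ b) ∧ (c ∧ (d ∧ e)) ≡ (a ∧ c) ∧ (d ∧ (b ∧ e))
  shuffle false _     _     _     _ = refl
  shuffle true  false false _     _ = refl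
  shuffle true  false true  false _ = refl
  shuffle true  false true  true  _ = refl
  shuffle true  true  false _     _ = refl
  shuffle true  true  true  false _ = refl
  shuffle true  true  true  true  _ = refl

compatibleAcross-far : ∀ q k → compatibleAcross q [ length q + suc k ] ≡ belowStaircase (suc k) q
compatibleAcross-far []      k = refl
compatibleAcross-far (x ∷ q) k = begin
  (compatible x (suc (length q)) (suc (length q + suc k)) ∧ true) ∧ compatibleAcross q [ suc (length q + suc k) ]
    ≡⟨ cong₂ _∧_ (trans (∧-identityʳ _) (compatible-far x (suc (length q)) k))
                 (cong (λ y → compatibleAcross q [ y ]) (sym (+-suc (length q) (suc k)))) ⟩
  (x ≤ᵇ suc k) ∧ compatibleAcross q [ length q + suc (suc k) ]
    ≡⟨ cong ((x ≤ᵇ suc k) ∧_) (compatibleAcross-far q (suc k)) ⟩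
  (x ≤ᵇ suc k) ∧ belowStaircase (suc (suc k)) q ∎

compatibleWithAll-belowStaircase : ∀ x {δ k} q → T (belowStaircase k q) → k ≤ δ → T (compatibleWithAll x δ q)
compatibleWithAll-belowStaircase x []      _ _   = _
compatibleWithAll-belowStaircase x (y ∷ q) t k≤δ with Equivalence.to T-∧ t
... | y≤k , t′ = Equivalence.from T-∧
  ( compatible-near x (≤-trans (≤ᵇ⇒≤ y _ y≤k) k≤δ)
  , compatibleWithAll-belowStaircase x q t′ (s≤s k≤δ))

compatibleAcross-peak : ∀ p q → T (belowStaircase 1 q) → T (compatibleAcross p (q ++ [ suc (length q) ]))
compatibleAcross-peak []      q _ = _
compatibleAcross-peak (x ∷ p) q t = Equivalence.from T-∧ (withQ , compatibleAcross-peak p q t)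
  where
  δ = suc (length p)
  withQ : T (compatibleWithAll x δ (q ++ [ suc (length q) ]))
  withQ = subst T (sym (compatibleWithAll-++ x δ q _)) (Equivalence.from T-∧
    ( compatibleWithAll-belowStaircase x q t (s≤s z≤n)
    , Equivalence.from T-∧ (compatible-near x (s≤s (m≤n+m (length q) (length p))) , _)))

-- A final entry |q| + 1 right after the block q decouples q from everything before it.
validList-peak : ∀ p q →
  validList (p ++ (q ++ [ suc (length q) ])) ≡ validList p ∧ (belowStaircase 1 q ∧ validList q)
validList-peak p q = begin
  validList (p ++ (q ++ [ s ]))
    ≡⟨ validList-++ p (q ++ [ s ]) ⟩
  validList p ∧ (validList (q ++ [ s ]) ∧ compatibleAcross p (q ++ [ s ]))
    ≡⟨ cong (λ b → validList p ∧ (b ∧ compatibleAcross p (q ++ [ s ]))) (validList-++ q [ s ]) ⟩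
  validList p ∧ ((validList q ∧ compatibleAcross q [ s ]) ∧ compatibleAcross p (q ++ [ s ]))
    ≡⟨ cong (λ b → validList p ∧ ((validList q ∧ b) ∧ compatibleAcross p (q ++ [ s ]))) q-below ⟩
  validList p ∧ ((validList q ∧ belowStaircase 1 q) ∧ compatibleAcross p (q ++ [ s ]))
    ≡⟨ cong (validList p ∧_) (∧-guard (validList q) (belowStaircase 1 q) (compatibleAcross-peak p q)) ⟩
  validList p ∧ (belowStaircase 1 q ∧ validList q) ∎
  where
  s = suc (length q)
  q-below : compatibleAcross q [ s ] ≡ belowStaircase 1 q
  q-below = trans (cong (λ y → compatibleAcross q [ y ]) (+-comm 1 (length q))) (compatibleAcross-far q 0)
  ∧-guard : ∀ a b {c} → (T b → T c) → (a ∧ b) ∧ c ≡ b ∧ a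
  ∧-guard false false _   = refl
  ∧-guard false true  _   = refl
  ∧-guard true  false _   = refl
  ∧-guard true  true  b⇒c = T-injective (λ _ → _) (λ _ → b⇒c _)

validList-far : ∀ p k → validList (p ++ [ length p + suc k ]) ≡ belowStaircase (suc k) p ∧ validList p
validList-far p k = begin
  validList (p ++ [ length p + suc k ])           ≡⟨ validList-++ p [ length p + suc k ] ⟩
  validList p ∧ compatibleAcross p [ length p + suc k ]  ≡⟨ cong (validList p ∧_) (compatibleAcross-far p k) ⟩
  validList p ∧ belowStaircase (suc k) p          ≡⟨ ∧-comm (validList p) _ ⟩
  belowStaircase (suc k) p ∧ validList p          ∎

-- Counting valid lists in boxes

𝟙 : Bool → ℕ
𝟙 true  = 1
𝟙 false = 0

𝟙-∧ : ∀ a b → 𝟙 (a ∧ b) ≡ 𝟙 a * 𝟙 b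
𝟙-∧ true  true  = refl
𝟙-∧ true  false = refl
𝟙-∧ false b     = refl

∑box : List ℕ → (List ℕ → ℕ) → ℕ
∑box []       f = f []
∑box (b ∷ bs) f = ∑[ x < b ] ∑box bs (λ u → f (suc x ∷ u))

∑box-cong : ∀ bs {f g : List ℕ → ℕ} → (∀ u → length u ≡ length bs → f u ≡ g u) → ∑box bs f ≡ ∑box bs g
∑box-cong []       f≗g = f≗g [] refl
∑box-cong (b ∷ bs) f≗g = ∑-cong b (λ x _ → ∑box-cong bs (λ u ∣u∣≡ → f≗g (suc x ∷ u) (cong suc ∣u∣≡)))

∑box-++ : ∀ bs cs (f : List ℕ → ℕ) → ∑box (bs ++ cs) f ≡ ∑box bs (λ p → ∑box cs (λ q → f (p ++ q)))
∑box-++ []       cs f = refl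
∑box-++ (b ∷ bs) cs f = ∑-cong b (λ x _ → ∑box-++ bs cs (λ u → f (suc x ∷ u)))

*-distribʳ-∑box : ∀ bs c (f : List ℕ → ℕ) → ∑box bs f * c ≡ ∑box bs (λ u → f u * c)
*-distribʳ-∑box []       c f = refl
*-distribʳ-∑box (b ∷ bs) c f =
  trans (*-distribʳ-∑ b c _) (∑-cong b (λ x _ → *-distribʳ-∑box bs c (λ u → f (suc x ∷ u))))

*-distribˡ-∑box : ∀ bs c (f : List ℕ → ℕ) → c * ∑box bs f ≡ ∑box bs (λ u → c * f u)
*-distribˡ-∑box bs c f = begin
  c * ∑box bs f                 ≡⟨ *-comm c _ ⟩
  ∑box bs f * c                 ≡⟨ *-distribʳ-∑box bs c f ⟩
  ∑box bs (λ u → f u * c)       ≡⟨ ∑box-cong bs (λ u _ → *-comm (f u) c) ⟩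
  ∑box bs (λ u → c * f u)       ∎

∑box-zero : ∀ bs (f : List ℕ → ℕ) → (∀ u → f u ≡ 0) → ∑box bs f ≡ 0
∑box-zero []       f f≗0 = f≗0 []
∑box-zero (b ∷ bs) f f≗0 = ∑-zero b _ (λ x _ → ∑box-zero bs _ (λ u → f≗0 (suc x ∷ u)))

∑box-∑ : ∀ bs b (g : List ℕ → ℕ → ℕ) → ∑box bs (λ p → ∑ b (g p)) ≡ ∑[ s < b ] ∑box bs (λ p → g p s)
∑box-∑ []        b g = refl
∑box-∑ (b′ ∷ bs) b g =
  trans (∑-cong b′ (λ x _ → ∑box-∑ bs b (λ u → g (suc x ∷ u)))) (∑-comm b′ b _)

staircase : ℕ → ℕ → List ℕ
staircase a zero    = []
staircase a (suc r) = a ∷ staircase (suc a) r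

length-staircase : ∀ a r → length (staircase a r) ≡ r
length-staircase a zero    = refl
length-staircase a (suc r) = cong suc (length-staircase (suc a) r)

staircase-++ : ∀ a x y → staircase a (x + y) ≡ staircase a x ++ staircase (a + x) y
staircase-++ a zero    y = cong (λ b → staircase b y) (sym (+-identityʳ a))
staircase-++ a (suc x) y =
  cong (a ∷_) (trans (staircase-++ (suc a) x y) (cong (λ b → staircase (suc a) x ++ staircase b y) (sym (+-suc a x))))

replicate-++ : ∀ x y (n : ℕ) → replicate (x + y) n ≡ replicate x n ++ replicate y n
replicate-++ zero    y n = refl
replicate-++ (suc x) y n = cong (n ∷_) (replicate-++ x y n)

StaircaseFits : ℕ → List ℕ → Set
StaircaseFits k bs = Pointwise _≤_ (staircase k (length bs)) bs

staircase-fits-replicate : ∀ {k n} r → k + r ≤ suc n → StaircaseFits k (replicate r n)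
staircase-fits-replicate zero    _ = []
staircase-fits-replicate {k} {n} (suc r) k+r+1≤n+1 =
  ≤-trans (m≤m+n k r) (s≤s⁻¹ k+1+r≤n+1) ∷ staircase-fits-replicate r k+1+r≤n+1
  where
  k+1+r≤n+1 : suc k + r ≤ suc n
  k+1+r≤n+1 = subst (_≤ suc n) (+-suc k r) k+r+1≤n+1

staircase-fits-staircase : ∀ {k a} r → k ≤ a → StaircaseFits k (staircase a r)
staircase-fits-staircase zero    _   = []
staircase-fits-staircase (suc r) k≤a = k≤a ∷ staircase-fits-staircase r (s≤s k≤a)

∑box-belowStaircase : ∀ bs k (P : List ℕ → Bool) → StaircaseFits k bs →
  ∑box bs (λ u → 𝟙 (belowStaircase k u ∧ P u)) ≡ ∑box (staircase k (length bs)) (λ u → 𝟙 (P u))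
∑box-belowStaircase []       k P []            = refl
∑box-belowStaircase (b ∷ bs) k P (k≤b ∷ fits) = begin
  ∑[ x < b ] ∑box bs (λ u → 𝟙 (((suc x ≤ᵇ k) ∧ belowStaircase (suc k) u) ∧ P (suc x ∷ u)))
    ≡⟨ ∑-truncate k b _ k≤b (λ x k≤x _ → ∑box-zero bs _ (λ u →
         cong (λ c → 𝟙 ((c ∧ belowStaircase (suc k) u) ∧ P (suc x ∷ u))) (>⇒≤ᵇ≡false (s≤s k≤x)))) ⟩
  ∑[ x < k ] ∑box bs (λ u → 𝟙 (((suc x ≤ᵇ k) ∧ belowStaircase (suc k) u) ∧ P (suc x ∷ u)))
    ≡⟨ ∑-cong k (λ x x<k → trans
         (∑box-cong bs (λ u _ → cong (λ c → 𝟙 ((c ∧ belowStaircase (suc k) u) ∧ P (suc x ∷ u))) (≤⇒≤ᵇ≡true x<k)))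
         (∑box-belowStaircase bs (suc k) (λ u → P (suc x ∷ u)) fits)) ⟩
  ∑[ x < k ] ∑box (staircase (suc k) (length bs)) (λ u → 𝟙 (P (suc x ∷ u))) ∎

countValidIn : List ℕ → ℕ
countValidIn bs = ∑box bs (λ u → 𝟙 (validList u))

squareCount : ℕ → ℕ → ℕ
squareCount n m = countValidIn (replicate m n)

stairCount : ℕ → ℕ → ℕ
stairCount d r = countValidIn (staircase (suc d) r)

squareConvolution : ℕ → ℕ → ℕ
squareConvolution n m = ∑[ s < suc m ] (squareCount n (m ∸ s) * stairCount 0 s)

stairConvolution : ℕ → ℕ → ℕ
stairConvolution d r = ∑[ s < suc r ] (stairCount d (r ∸ s) * stairCount 0 s)

endingWith : List ℕ → ℕ → ℕ
endingWith bs s = ∑box bs (λ p → 𝟙 (validList (p ++ [ suc s ])))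

endingWith-peak : ∀ bs₁ bs₂ → StaircaseFits 1 bs₂ →
  endingWith (bs₁ ++ bs₂) (length bs₂) ≡ countValidIn bs₁ * stairCount 0 (length bs₂)
endingWith-peak bs₁ bs₂ fits = begin
  ∑box (bs₁ ++ bs₂) (λ u → 𝟙 (validList (u ++ [ suc (length bs₂) ])))
    ≡⟨ ∑box-++ bs₁ bs₂ _ ⟩
  ∑box bs₁ (λ p → ∑box bs₂ (λ q → 𝟙 (validList ((p ++ q) ++ [ suc (length bs₂) ]))))
    ≡⟨ ∑box-cong bs₁ (λ p _ → trans (∑box-cong bs₂ (λ q ∣q∣≡ → factor p q ∣q∣≡))
                                    (sym (*-distribˡ-∑box bs₂ (𝟙 (validList p)) _))) ⟩
  ∑box bs₁ (λ p → 𝟙 (validList p) * ∑box bs₂ (λ q → 𝟙 (belowStaircase 1 q ∧ validList q)))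
    ≡⟨ sym (*-distribʳ-∑box bs₁ _ (λ p → 𝟙 (validList p))) ⟩
  countValidIn bs₁ * ∑box bs₂ (λ q → 𝟙 (belowStaircase 1 q ∧ validList q))
    ≡⟨ cong (countValidIn bs₁ *_) (∑box-belowStaircase bs₂ 1 validList fits) ⟩
  countValidIn bs₁ * stairCount 0 (length bs₂) ∎
  where
  factor : ∀ p q → length q ≡ length bs₂ →
    𝟙 (validList ((p ++ q) ++ [ suc (length bs₂) ])) ≡ 𝟙 (validList p) * 𝟙 (belowStaircase 1 q ∧ validList q)
  factor p q ∣q∣≡ = begin
    𝟙 (validList ((p ++ q) ++ [ suc (length bs₂) ]))     ≡⟨ cong (λ t → 𝟙 (validList ((p ++ q) ++ [ suc t ]))) (sym ∣q∣≡) ⟩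
    𝟙 (validList ((p ++ q) ++ [ suc (length q) ]))       ≡⟨ cong (λ u → 𝟙 (validList u)) (++-assoc p q _) ⟩
    𝟙 (validList (p ++ (q ++ [ suc (length q) ])))       ≡⟨ cong 𝟙 (validList-peak p q) ⟩
    𝟙 (validList p ∧ (belowStaircase 1 q ∧ validList q)) ≡⟨ 𝟙-∧ (validList p) _ ⟩
    𝟙 (validList p) * 𝟙 (belowStaircase 1 q ∧ validList q) ∎

endingWith-far : ∀ bs e → StaircaseFits (suc (suc e)) bs →
  endingWith bs (length bs + suc e) ≡ stairCount (suc e) (length bs)
endingWith-far bs e fits = trans
  (∑box-cong bs (λ p ∣p∣≡ → cong 𝟙 (trans
    (cong (λ y → validList (p ++ [ y ])) (trans (sym (+-suc (length bs) (suc e))) (cong (_+ suc (suc e)) (sym ∣p∣≡))))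
    (validList-far p (suc e)))))
  (∑box-belowStaircase bs (suc (suc e)) validList fits)

-- Splitting by the last entry s + 1 of a valid list in the box bs ++ [b]: for s ≤ |bs| the
-- last s entries form an independent block (endingWith-peak), otherwise the whole prefix is
-- confined under a staircase (endingWith-far).
countValidIn-snoc : ∀ {m} bs b (front back : ℕ → List ℕ) → length bs ≡ m → m < b →
  (∀ s → s ≤ m → bs ≡ front s ++ back s) →
  (∀ s → s ≤ m → length (back s) ≡ s) →
  (∀ s → s ≤ m → StaircaseFits 1 (back s)) →
  (∀ e → e < b ∸ suc m → StaircaseFits (suc (suc e)) bs) →
  countValidIn (bs ++ [ b ]) ≡
    ∑[ s < suc m ] (countValidIn (front s) * stairCount 0 s) + ∑[ e < b ∸ suc m ] stairCount (suc e) m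
countValidIn-snoc {m} bs b front back refl m<b split ∣back∣≡ back-fits bs-fits = begin
  countValidIn (bs ++ [ b ])
    ≡⟨ ∑box-++ bs [ b ] _ ⟩
  ∑box bs (λ p → ∑[ s < b ] 𝟙 (validList (p ++ [ suc s ])))
    ≡⟨ ∑box-∑ bs b (λ p s → 𝟙 (validList (p ++ [ suc s ]))) ⟩
  ∑ b (endingWith bs)
    ≡⟨ cong (λ c → ∑ c (endingWith bs)) (sym (m+[n∸m]≡n m<b)) ⟩
  ∑ (suc m + (b ∸ suc m)) (endingWith bs)
    ≡⟨ ∑-split (suc m) (b ∸ suc m) (endingWith bs) ⟩
  ∑ (suc m) (endingWith bs) + ∑[ e < b ∸ suc m ] endingWith bs (suc m + e)
    ≡⟨ cong₂ _+_ (∑-cong (suc m) peak) (∑-cong (b ∸ suc m) far) ⟩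
  ∑[ s < suc m ] (countValidIn (front s) * stairCount 0 s) + ∑[ e < b ∸ suc m ] stairCount (suc e) m ∎
  where
  peak : ∀ s → s < suc m → endingWith bs s ≡ countValidIn (front s) * stairCount 0 s
  peak s s<1+m = begin
    endingWith bs s                                   ≡⟨ cong₂ endingWith (split s s≤m) (sym (∣back∣≡ s s≤m)) ⟩
    endingWith (front s ++ back s) (length (back s))  ≡⟨ endingWith-peak (front s) (back s) (back-fits s s≤m) ⟩
    countValidIn (front s) * stairCount 0 (length (back s)) ≡⟨ cong (λ t → countValidIn (front s) * stairCount 0 t) (∣back∣≡ s s≤m) ⟩
    countValidIn (front s) * stairCount 0 s           ∎
    where s≤m = s≤s⁻¹ s<1+m
  far : ∀ e → e < b ∸ suc m → endingWith bs (suc m + e) ≡ stairCount (suc e) m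
  far e e< = trans (cong (endingWith bs) (sym (+-suc m e))) (endingWith-far bs e (bs-fits e e<))

squareCount-suc : ∀ n m → m < n →
  squareCount n (suc m) ≡ squareConvolution n m + ∑[ e < n ∸ suc m ] stairCount (suc e) m
squareCount-suc n m m<n = begin
  countValidIn (replicate (suc m) n)
    ≡⟨ cong countValidIn (trans (cong (λ t → replicate t n) (+-comm 1 m)) (replicate-++ m 1 n)) ⟩
  countValidIn (replicate m n ++ [ n ])
    ≡⟨ countValidIn-snoc (replicate m n) n (λ s → replicate (m ∸ s) n) (λ s → replicate s n)
         (length-replicate m) m<n split (λ s _ → length-replicate s) back-fits bs-fits ⟩
  squareConvolution n m + ∑[ e < n ∸ suc m ] stairCount (suc e) m ∎
  where
  split : ∀ s → s ≤ m → replicate m n ≡ replicate (m ∸ s) n ++ replicate s n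
  split s s≤m = trans (cong (λ t → replicate t n) (sym (m∸n+n≡m s≤m))) (replicate-++ (m ∸ s) s n)
  back-fits : ∀ s → s ≤ m → StaircaseFits 1 (replicate s n)
  back-fits s s≤m = staircase-fits-replicate s (s≤s (≤-trans s≤m (<⇒≤ m<n)))
  bs-fits : ∀ e → e < n ∸ suc m → StaircaseFits (suc (suc e)) (replicate m n)
  bs-fits e e< = staircase-fits-replicate m (s≤s (≤-trans (≤-reflexive (cong suc (+-comm e m)))
    (<⇒≤ (subst (suc m + e <_) (m+[n∸m]≡n m<n) (+-monoʳ-< (suc m) e<)))))

stairCount-suc : ∀ d r → stairCount d (suc r) ≡ stairConvolution d r + ∑[ e < d ] stairCount (suc e) r
stairCount-suc d r = begin
  countValidIn (staircase (suc d) (suc r))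
    ≡⟨ cong countValidIn (trans (cong (staircase (suc d)) (+-comm 1 r)) (staircase-++ (suc d) r 1)) ⟩
  countValidIn (staircase (suc d) r ++ [ suc d + r ])
    ≡⟨ countValidIn-snoc (staircase (suc d) r) (suc d + r)
         (λ s → staircase (suc d) (r ∸ s)) (λ s → staircase (suc d + (r ∸ s)) s)
         (length-staircase (suc d) r) (s≤s (m≤n+m r d)) split (λ s _ → length-staircase _ s)
         (λ s _ → staircase-fits-staircase s (s≤s z≤n)) bs-fits ⟩
  stairConvolution d r + ∑[ e < (suc d + r) ∸ suc r ] stairCount (suc e) r
    ≡⟨ cong (λ t → stairConvolution d r + ∑[ e < t ] stairCount (suc e) r) (m+n∸n≡m d r) ⟩
  stairConvolution d r + ∑[ e < d ] stairCount (suc e) r ∎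
  where
  split : ∀ s → s ≤ r → staircase (suc d) r ≡ staircase (suc d) (r ∸ s) ++ staircase (suc d + (r ∸ s)) s
  split s s≤r = trans (cong (staircase (suc d)) (sym (m∸n+n≡m s≤r))) (staircase-++ (suc d) (r ∸ s) s)
  bs-fits : ∀ e → e < (suc d + r) ∸ suc r → StaircaseFits (suc (suc e)) (staircase (suc d) r)
  bs-fits e e< = staircase-fits-staircase r (s≤s (subst (e <_) (m+n∸n≡m d r) e<))

-- Ballot numbers from the counting recursions

stairCount-suc-∑-from : ∀ d r → (∀ d′ → stairConvolution d′ r ≡ stairCount (suc d′) r) →
  stairCount d (suc r) ≡ ∑[ e < suc d ] stairCount (suc e) r
stairCount-suc-∑-from d r conv = begin
  stairCount d (suc r)
    ≡⟨ stairCount-suc d r ⟩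
  stairConvolution d r + ∑[ e < d ] stairCount (suc e) r
    ≡⟨ cong (_+ ∑[ e < d ] stairCount (suc e) r) (conv d) ⟩
  stairCount (suc d) r + ∑[ e < d ] stairCount (suc e) r
    ≡⟨ +-comm (stairCount (suc d) r) _ ⟩
  ∑[ e < d ] stairCount (suc e) r + stairCount (suc d) r
    ≡⟨ sym (∑-last d (λ e → stairCount (suc e) r)) ⟩
  ∑[ e < suc d ] stairCount (suc e) r ∎

stairConvolution≡stairCount : ∀ r d → stairConvolution d r ≡ stairCount (suc d) r
stairConvolution≡stairCount = <-rec _ step
  where
  step : ∀ r → (∀ {j} → j < r → ∀ d → stairConvolution d j ≡ stairCount (suc d) j) →
    ∀ d → stairConvolution d r ≡ stairCount (suc d) r
  step zero    _  d = refl
  step (suc r) ih d = begin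
    stairConvolution d (suc r)
      ≡⟨ ∑-last (suc r) (λ s → stairCount d (suc r ∸ s) * stairCount 0 s) ⟩
    ∑[ s < suc r ] (stairCount d (suc r ∸ s) * stairCount 0 s) + stairCount d (suc r ∸ suc r) * stairCount 0 (suc r)
      ≡⟨ cong₂ _+_ inner last ⟩
    ∑[ e < suc d ] stairCount (suc (suc e)) r + stairCount 1 r
      ≡⟨ +-comm _ (stairCount 1 r) ⟩
    ∑[ e < suc (suc d) ] stairCount (suc e) r
      ≡⟨ sym (stairCount-suc-∑-from (suc d) r (ih ≤-refl)) ⟩
    stairCount (suc d) (suc r) ∎
    where
    inner : ∑[ s < suc r ] (stairCount d (suc r ∸ s) * stairCount 0 s) ≡ ∑[ e < suc d ] stairCount (suc (suc e)) r
    inner = begin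
      ∑[ s < suc r ] (stairCount d (suc r ∸ s) * stairCount 0 s)
        ≡⟨ ∑-cong (suc r) (λ s s≤r → cong (_* stairCount 0 s) (trans
             (cong (stairCount d) (+-∸-assoc 1 (s≤s⁻¹ s≤r)))
             (stairCount-suc-∑-from d (r ∸ s) (ih (s≤s (m∸n≤m r s)))))) ⟩
      ∑[ s < suc r ] (∑[ e < suc d ] stairCount (suc e) (r ∸ s) * stairCount 0 s)
        ≡⟨ ∑-cong (suc r) (λ s _ → *-distribʳ-∑ (suc d) (stairCount 0 s) (λ e → stairCount (suc e) (r ∸ s))) ⟩
      ∑[ s < suc r ] ∑[ e < suc d ] (stairCount (suc e) (r ∸ s) * stairCount 0 s)
        ≡⟨ ∑-comm (suc r) (suc d) (λ s e → stairCount (suc e) (r ∸ s) * stairCount 0 s) ⟩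
      ∑[ e < suc d ] stairConvolution (suc e) r
        ≡⟨ ∑-cong (suc d) (λ e _ → ih ≤-refl (suc e)) ⟩
      ∑[ e < suc d ] stairCount (suc (suc e)) r ∎
    last : stairCount d (suc r ∸ suc r) * stairCount 0 (suc r) ≡ stairCount 1 r
    last = begin
      stairCount d (r ∸ r) * stairCount 0 (suc r)
        ≡⟨ cong (λ t → stairCount d t * stairCount 0 (suc r)) (n∸n≡0 r) ⟩
      stairCount 0 (suc r) + 0
        ≡⟨ +-identityʳ _ ⟩
      stairCount 0 (suc r)
        ≡⟨ stairCount-suc-∑-from 0 r (ih ≤-refl) ⟩
      stairCount 1 r + 0
        ≡⟨ +-identityʳ _ ⟩
      stairCount 1 r ∎

stairCount-suc-∑ : ∀ d r → stairCount d (suc r) ≡ ∑[ e < suc d ] stairCount (suc e) r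
stairCount-suc-∑ d r = stairCount-suc-∑-from d r (stairConvolution≡stairCount r)

stairCount≡ballot : ∀ r d → stairCount d r ≡ ballot (suc (r + d)) r
stairCount≡ballot zero    d = refl
stairCount≡ballot (suc r) d = begin
  stairCount d (suc r)                           ≡⟨ stairCount-suc-∑ d r ⟩
  ∑[ e < suc d ] stairCount (suc e) r            ≡⟨ ∑-cong (suc d) (λ e _ → stairCount≡ballot r (suc e)) ⟩
  ∑[ e < suc d ] ballot (suc (r + suc e)) r      ≡⟨ sym (ballot-unroll r d) ⟩
  ballot (suc (suc r + d)) (suc r)               ∎

stairCount-zero≡catalanℕ : ∀ r → stairCount 0 r ≡ catalanℕ r
stairCount-zero≡catalanℕ r = trans (stairCount≡ballot r 0) (cong (λ t → ballot (suc t) r) (+-identityʳ r))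

catalanℕ-suc : ∀ m → catalanℕ (suc m) ≡ ∑[ s < suc m ] (catalanℕ (m ∸ s) * catalanℕ s)
catalanℕ-suc m = begin
  catalanℕ (suc m)
    ≡⟨ sym (stairCount-zero≡catalanℕ (suc m)) ⟩
  stairCount 0 (suc m)
    ≡⟨ stairCount-suc 0 m ⟩
  stairConvolution 0 m + 0
    ≡⟨ +-identityʳ _ ⟩
  stairConvolution 0 m
    ≡⟨ ∑-cong (suc m) (λ s _ → cong₂ _*_ (stairCount-zero≡catalanℕ (m ∸ s)) (stairCount-zero≡catalanℕ s)) ⟩
  ∑[ s < suc m ] (catalanℕ (m ∸ s) * catalanℕ s) ∎

squareConvolution-pascal : ∀ n m →
  (∀ j → j ≤ m → squareCount (suc n) (suc j) ≡ squareCount n (suc j) + squareCount (suc n) j) →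
  squareConvolution (suc n) (suc m) ≡ squareConvolution n (suc m) + squareConvolution (suc n) m
squareConvolution-pascal n m pascal = begin
  squareConvolution (suc n) (suc m)
    ≡⟨ ∑-last (suc m) (λ s → squareCount (suc n) (suc m ∸ s) * stairCount 0 s) ⟩
  ∑[ s < suc m ] (squareCount (suc n) (suc m ∸ s) * stairCount 0 s) + L (suc n)
    ≡⟨ cong (_+ L (suc n)) (trans (∑-cong (suc m) split)
         (∑-distrib-+ (suc m) (λ s → squareCount n (suc m ∸ s) * stairCount 0 s)
                              (λ s → squareCount (suc n) (m ∸ s) * stairCount 0 s))) ⟩
  (X + squareConvolution (suc n) m) + L (suc n)
    ≡⟨ xy∙z≈xz∙y X _ _ ⟩
  (X + L (suc n)) + squareConvolution (suc n) m
    ≡⟨ cong (λ t → (X + t) + squareConvolution (suc n) m) (L-independent) ⟩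
  (X + L n) + squareConvolution (suc n) m
    ≡⟨ cong (_+ squareConvolution (suc n) m) (sym (∑-last (suc m) (λ s → squareCount n (suc m ∸ s) * stairCount 0 s))) ⟩
  squareConvolution n (suc m) + squareConvolution (suc n) m ∎
  where
  X = ∑[ s < suc m ] (squareCount n (suc m ∸ s) * stairCount 0 s)
  L : ℕ → ℕ
  L n′ = squareCount n′ (suc m ∸ suc m) * stairCount 0 (suc m)
  L-independent : L (suc n) ≡ L n
  L-independent = trans (cong (λ t → squareCount (suc n) t * stairCount 0 (suc m)) (n∸n≡0 m))
                        (sym (cong (λ t → squareCount n t * stairCount 0 (suc m)) (n∸n≡0 m)))
  split : ∀ s → s < suc m →
    squareCount (suc n) (suc m ∸ s) * stairCount 0 s ≡
      squareCount n (suc m ∸ s) * stairCount 0 s + squareCount (suc n) (m ∸ s) * stairCount 0 s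
  split s s≤m = begin
    squareCount (suc n) (suc m ∸ s) * stairCount 0 s
      ≡⟨ cong (λ t → squareCount (suc n) t * stairCount 0 s) 1+m∸s≡1+[m∸s] ⟩
    squareCount (suc n) (suc (m ∸ s)) * stairCount 0 s
      ≡⟨ cong (_* stairCount 0 s) (pascal (m ∸ s) (m∸n≤m m s)) ⟩
    (squareCount n (suc (m ∸ s)) + squareCount (suc n) (m ∸ s)) * stairCount 0 s
      ≡⟨ *-distribʳ-+ (stairCount 0 s) (squareCount n (suc (m ∸ s))) _ ⟩
    squareCount n (suc (m ∸ s)) * stairCount 0 s + squareCount (suc n) (m ∸ s) * stairCount 0 s
      ≡⟨ cong (λ t → squareCount n t * stairCount 0 s + squareCount (suc n) (m ∸ s) * stairCount 0 s)
           (sym 1+m∸s≡1+[m∸s]) ⟩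
    squareCount n (suc m ∸ s) * stairCount 0 s + squareCount (suc n) (m ∸ s) * stairCount 0 s ∎
    where
    1+m∸s≡1+[m∸s] : suc m ∸ s ≡ suc (m ∸ s)
    1+m∸s≡1+[m∸s] = +-∸-assoc 1 (s≤s⁻¹ s≤m)

m∸n≡1+[m∸1+n] : ∀ {m n} → n < m → m ∸ n ≡ suc (m ∸ suc n)
m∸n≡1+[m∸1+n] {suc m} {zero}  _         = refl
m∸n≡1+[m∸1+n] {suc m} {suc n} (s≤s n<m) = m∸n≡1+[m∸1+n] n<m

squareCount-pascal : ∀ m n → suc m ≤ n → squareCount (suc n) (suc m) ≡ squareCount n (suc m) + squareCount (suc n) m
squareCount-pascal = <-rec Pascal step
  where
  Pascal : ℕ → Set
  Pascal m = ∀ n → suc m ≤ n → squareCount (suc n) (suc m) ≡ squareCount n (suc m) + squareCount (suc n) m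
  step : ∀ m → (∀ {j} → j < m → Pascal j) → Pascal m
  step zero _ (suc k) _ = begin
    squareCount (suc (suc k)) 1                  ≡⟨ squareCount-suc (suc (suc k)) 0 (s≤s z≤n) ⟩
    1 + (1 + ∑[ e < k ] 1)                        ≡⟨ +-comm 1 (1 + ∑[ e < k ] 1) ⟩
    (1 + ∑[ e < k ] 1) + 1                        ≡⟨ cong (_+ 1) (sym (squareCount-suc (suc k) 0 (s≤s z≤n))) ⟩
    squareCount (suc k) 1 + squareCount (suc (suc k)) 0 ∎
  step (suc m) ih n m+2≤n = begin
    squareCount (suc n) (suc M)
      ≡⟨ squareCount-suc (suc n) M (m≤n⇒m≤1+n m+2≤n) ⟩
    squareConvolution (suc n) M + ∑[ e < suc n ∸ suc M ] stairCount (suc e) M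
      ≡⟨ cong₂ _+_ (squareConvolution-pascal n m (λ j j≤m → ih (s≤s j≤m) n (≤-trans (s≤s j≤m) m+1≤n)))
                   (trans (cong (λ t → ∑[ e < t ] stairCount (suc e) M) n∸M≡1+k) (∑-last k (λ e → stairCount (suc e) M))) ⟩
    (squareConvolution n M + squareConvolution (suc n) m) + (∑[ e < k ] stairCount (suc e) M + stairCount (suc k) M)
      ≡⟨ interchange (squareConvolution n M) _ _ _ ⟩
    (squareConvolution n M + ∑[ e < k ] stairCount (suc e) M) + (squareConvolution (suc n) m + stairCount (suc k) M)
      ≡⟨ cong₂ _+_ (sym (squareCount-suc n M m+2≤n)) tail ⟩
    squareCount n (suc M) + squareCount (suc n) M ∎
    where
    M = suc m
    k = n ∸ suc M
    m+1≤n : suc m ≤ n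
    m+1≤n = ≤-trans (n≤1+n (suc m)) m+2≤n
    n∸M≡1+k : n ∸ M ≡ suc k
    n∸M≡1+k = m∸n≡1+[m∸1+n] m+2≤n
    tail : squareConvolution (suc n) m + stairCount (suc k) M ≡ squareCount (suc n) M
    tail = begin
      squareConvolution (suc n) m + stairCount (suc k) M
        ≡⟨ cong (_+_ (squareConvolution (suc n) m)) (stairCount-suc-∑ (suc k) m) ⟩
      squareConvolution (suc n) m + ∑[ e < suc (suc k) ] stairCount (suc e) m
        ≡⟨ cong (λ t → squareConvolution (suc n) m + ∑[ e < t ] stairCount (suc e) m) (sym n∸m≡2+k) ⟩
      squareConvolution (suc n) m + ∑[ e < suc n ∸ suc m ] stairCount (suc e) m
        ≡⟨ sym (squareCount-suc (suc n) m (m≤n⇒m≤1+n m+1≤n)) ⟩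
      squareCount (suc n) M ∎
      where
      n∸m≡2+k : n ∸ m ≡ suc (suc k)
      n∸m≡2+k = trans (m∸n≡1+[m∸1+n] m+1≤n) (cong suc n∸M≡1+k)

squareCount-diagonal : ∀ n → squareCount (suc n) (suc n) ≡ ∑[ s < suc n ] (squareCount (suc n) (n ∸ s) * stairCount 0 s)
squareCount-diagonal n = begin
  squareCount (suc n) (suc n)
    ≡⟨ squareCount-suc (suc n) n ≤-refl ⟩
  squareConvolution (suc n) n + ∑[ e < n ∸ n ] stairCount (suc e) n
    ≡⟨ cong (λ t → squareConvolution (suc n) n + ∑[ e < t ] stairCount (suc e) n) (n∸n≡0 n) ⟩
  squareConvolution (suc n) n + 0
    ≡⟨ +-identityʳ _ ⟩
  squareConvolution (suc n) n ∎

ballotConvolution-pascal : ∀ n m → suc m ≤ n →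
  ballotConvolution (suc n) (suc m) ≡ ballotConvolution n (suc m) + ballotConvolution (suc n) m
ballotConvolution-pascal n m m<n = begin
  1 * catalanℕ (suc m) + ∑[ r < suc m ] (ballot (suc n) (suc r) * catalanℕ (m ∸ r))
    ≡⟨ cong (_+_ (1 * catalanℕ (suc m))) (trans (∑-cong (suc m) step)
         (∑-distrib-+ (suc m) (λ r → ballot n (suc r) * catalanℕ (m ∸ r))
                              (λ r → ballot (suc n) r * catalanℕ (m ∸ r)))) ⟩
  1 * catalanℕ (suc m) + (∑[ r < suc m ] (ballot n (suc r) * catalanℕ (m ∸ r)) + ballotConvolution (suc n) m)
    ≡⟨ sym (+-assoc (1 * catalanℕ (suc m)) _ _) ⟩
  ballotConvolution n (suc m) + ballotConvolution (suc n) m ∎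
  where
  step : ∀ r → r < suc m →
    ballot (suc n) (suc r) * catalanℕ (m ∸ r) ≡ ballot n (suc r) * catalanℕ (m ∸ r) + ballot (suc n) r * catalanℕ (m ∸ r)
  step r r≤m = trans (cong (_* catalanℕ (m ∸ r)) (ballot-step n r (≤-trans r≤m m<n)))
                     (*-distribʳ-+ (catalanℕ (m ∸ r)) (ballot n (suc r)) (ballot (suc n) r))

ballotConvolution-diagonal : ∀ n →
  ballotConvolution (suc n) (suc n) ≡ ∑[ s < suc n ] (ballotConvolution (suc n) (n ∸ s) * catalanℕ s)
ballotConvolution-diagonal n = begin
  ballotConvolution (suc n) (suc n)
    ≡⟨ ∑-last (suc n) (λ r → b r * catalanℕ (suc n ∸ r)) ⟩
  ∑[ r < suc n ] (b r * catalanℕ (suc n ∸ r)) + b (suc n) * catalanℕ (suc n ∸ suc n)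
    ≡⟨ cong (λ t → ∑[ r < suc n ] (b r * catalanℕ (suc n ∸ r)) + t * catalanℕ (n ∸ n)) (ballot-diagonal n) ⟩
  ∑[ r < suc n ] (b r * catalanℕ (suc n ∸ r)) + 0
    ≡⟨ +-identityʳ _ ⟩
  ∑[ r < suc n ] (b r * catalanℕ (suc n ∸ r))
    ≡⟨ ∑-cong (suc n) (λ r r≤n → cong (λ t → b r * t) (trans
         (cong catalanℕ (+-∸-assoc 1 (s≤s⁻¹ r≤n))) (catalanℕ-suc (n ∸ r)))) ⟩
  ∑[ r < suc n ] (b r * ∑[ s < suc (n ∸ r) ] (catalanℕ (n ∸ r ∸ s) * catalanℕ s))
    ≡⟨ ∑-cong (suc n) (λ r _ → *-distribˡ-∑ (suc (n ∸ r)) (b r) (λ s → catalanℕ (n ∸ r ∸ s) * catalanℕ s)) ⟩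
  ∑[ r < suc n ] ∑[ s < suc (n ∸ r) ] (b r * (catalanℕ (n ∸ r ∸ s) * catalanℕ s))
    ≡⟨ sym (∑-triangle n (λ r s → b r * (catalanℕ (n ∸ r ∸ s) * catalanℕ s))) ⟩
  ∑[ s < suc n ] ∑[ r < suc (n ∸ s) ] (b r * (catalanℕ (n ∸ r ∸ s) * catalanℕ s))
    ≡⟨ ∑-cong (suc n) (λ s _ → ∑-cong (suc (n ∸ s)) (λ r _ → trans (sym (*-assoc (b r) _ _))
         (cong (λ t → b r * catalanℕ t * catalanℕ s) (∸-swap n r s)))) ⟩
  ∑[ s < suc n ] ∑[ r < suc (n ∸ s) ] (b r * catalanℕ (n ∸ s ∸ r) * catalanℕ s)
    ≡⟨ ∑-cong (suc n) (λ s _ → sym (*-distribʳ-∑ (suc (n ∸ s)) (catalanℕ s) (λ r → b r * catalanℕ (n ∸ s ∸ r)))) ⟩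
  ∑[ s < suc n ] (ballotConvolution (suc n) (n ∸ s) * catalanℕ s) ∎
  where
  b : ℕ → ℕ
  b = ballot (suc n)
  ∸-swap : ∀ a r s → a ∸ r ∸ s ≡ a ∸ s ∸ r
  ∸-swap a r s = trans (∸-+-assoc a r s) (trans (cong (a ∸_) (+-comm r s)) (sym (∸-+-assoc a s r)))

squareCount≡ballotConvolution : ∀ n m → m ≤ n → squareCount n m ≡ ballotConvolution n m
squareCount≡ballotConvolution zero    zero z≤n    = refl
squareCount≡ballotConvolution (suc n) m    m≤n+1 =
  [ (λ m<n+1 → below m (s≤s⁻¹ m<n+1))
  , (λ m≡n+1 → subst (λ t → squareCount (suc n) t ≡ ballotConvolution (suc n) t) (sym m≡n+1) diagonal)
  ]′ (m≤n⇒m<n∨m≡n m≤n+1)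
  where
  below : ∀ m → m ≤ n → squareCount (suc n) m ≡ ballotConvolution (suc n) m
  below zero    _     = refl
  below (suc m) m+1≤n = begin
    squareCount (suc n) (suc m)                               ≡⟨ squareCount-pascal m n m+1≤n ⟩
    squareCount n (suc m) + squareCount (suc n) m             ≡⟨ cong₂ _+_ (squareCount≡ballotConvolution n (suc m) m+1≤n)
                                                                        (below m (≤-trans (n≤1+n m) m+1≤n)) ⟩
    ballotConvolution n (suc m) + ballotConvolution (suc n) m ≡⟨ sym (ballotConvolution-pascal n m m+1≤n) ⟩
    ballotConvolution (suc n) (suc m)                         ∎
  diagonal : squareCount (suc n) (suc n) ≡ ballotConvolution (suc n) (suc n)
  diagonal = begin
    squareCount (suc n) (suc n)
      ≡⟨ squareCount-diagonal n ⟩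
    ∑[ s < suc n ] (squareCount (suc n) (n ∸ s) * stairCount 0 s)
      ≡⟨ ∑-cong (suc n) (λ s _ → cong₂ _*_ (below (n ∸ s) (m∸n≤m n s)) (stairCount-zero≡catalanℕ s)) ⟩
    ∑[ s < suc n ] (ballotConvolution (suc n) (n ∸ s) * catalanℕ s)
      ≡⟨ sym (ballotConvolution-diagonal n) ⟩
    ballotConvolution (suc n) (suc n) ∎

-- Validity of vectors, via integer windows

window⇒ : ∀ x δ y → 1ℤ ℤ.≤ y ⊖ δ → y ⊖ δ ℤ.≤ x ⊖ 1 → δ < y × y < δ + x
window⇒ x δ y 1≤y⊖δ y⊖δ≤x⊖1 with y ≤? δ
... | yes y≤δ = contradiction (subst (1ℤ ℤ.≤_) (ℤ.⊖-≤ y≤δ) 1≤y⊖δ) (1≰- (δ ∸ y))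
  where
  1≰- : ∀ k → ¬ (1ℤ ℤ.≤ ℤ.- (+ k))
  1≰- zero    (ℤ.+≤+ ())
  1≰- (suc k) ()
... | no y≰δ with x | subst (ℤ._≤ x ⊖ 1) (ℤ.⊖-≥ (<⇒≤ (≰⇒> y≰δ))) y⊖δ≤x⊖1
...   | zero   | ()
...   | suc x′ | ℤ.+≤+ y∸δ≤x′ =
  ≰⇒> y≰δ , subst (_< δ + suc x′) (m+[n∸m]≡n (<⇒≤ (≰⇒> y≰δ))) (+-monoʳ-< δ (s≤s y∸δ≤x′))

window⇐ : ∀ x δ y → δ < y → y < δ + x → 1ℤ ℤ.≤ y ⊖ δ × y ⊖ δ ℤ.≤ x ⊖ 1
window⇐ zero     δ y δ<y y<δ+0 = contradiction (<-trans δ<y (subst (y <_) (+-identityʳ δ) y<δ+0)) (n≮n δ)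
window⇐ (suc x′) δ y δ<y y<δ+x rewrite ℤ.⊖-≥ (<⇒≤ δ<y) =
  ℤ.+≤+ (m<n⇒0<n∸m δ<y) , ℤ.+≤+ (m≤n+o⇒m∸n≤o y δ (s≤s⁻¹ (subst (y <_) (+-suc δ x′) y<δ+x)))

compatible⇔outsideWindow : ∀ x δ y → T (compatible x δ y) ⇔ (¬ (1ℤ ℤ.≤ y ⊖ δ × y ⊖ δ ℤ.≤ x ⊖ 1))
compatible⇔outsideWindow x δ y = mk⇔ to from
  where
  to : T (compatible x δ y) → ¬ (1ℤ ℤ.≤ y ⊖ δ × y ⊖ δ ℤ.≤ x ⊖ 1)
  to t (lower , upper) with window⇒ x δ y lower upper | Equivalence.to T-∨ t
  ... | _   , y<δ+x | inj₁ δ+x≤y = <⇒≱ y<δ+x (≤ᵇ⇒≤ (δ + x) y δ+x≤y)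
  ... | δ<y , _     | inj₂ y≤δ   = <⇒≱ δ<y (≤ᵇ⇒≤ y δ y≤δ)
  from : ¬ (1ℤ ℤ.≤ y ⊖ δ × y ⊖ δ ℤ.≤ x ⊖ 1) → T (compatible x δ y)
  from outside with y ≤? δ | δ + x ≤? y
  ... | yes y≤δ | _          = Equivalence.from T-∨ (inj₂ (≤⇒≤ᵇ y≤δ))
  ... | no _    | yes δ+x≤y  = Equivalence.from T-∨ (inj₁ (≤⇒≤ᵇ δ+x≤y))
  ... | no y≰δ  | no δ+x≰y   = contradiction (window⇐ x δ y (≰⇒> y≰δ) (≰⇒> δ+x≰y)) outside

AllCompatible : ∀ {m} → Vec ℕ m → Set
AllCompatible {m} u = (i j : Fin m) → i Fin.< j → T (compatible (lookup u i) (toℕ j ∸ toℕ i) (lookup u j))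

Valid⇔AllCompatible : ∀ {m} (u : Vec ℕ m) → Valid u ⇔ AllCompatible u
Valid⇔AllCompatible u = mk⇔
  (λ valid i j i<j → Equivalence.from (compatible⇔ i j i<j) (valid i j i<j))
  (λ allCompatible i j i<j → Equivalence.to (compatible⇔ i j i<j) (allCompatible i j i<j))
  where
  compatible⇔ : ∀ i j → i Fin.< j →
    T (compatible (lookup u i) (toℕ j ∸ toℕ i) (lookup u j)) ⇔
    (¬ ((1ℤ ℤ.≤ + lookup u j ℤ.- (+ toℕ j ℤ.- + toℕ i))
       × (+ lookup u j ℤ.- (+ toℕ j ℤ.- + toℕ i) ℤ.≤ + lookup u i ℤ.- 1ℤ)))
  compatible⇔ i j i<j
    rewrite ℤ.[+m]-[+n]≡m⊖n (toℕ j) (toℕ i) | ℤ.⊖-≥ (<⇒≤ i<j)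
          | ℤ.[+m]-[+n]≡m⊖n (lookup u j) (toℕ j ∸ toℕ i) | ℤ.[+m]-[+n]≡m⊖n (lookup u i) 1
    = compatible⇔outsideWindow (lookup u i) (toℕ j ∸ toℕ i) (lookup u j)

compatibleWithAll⇔lookup : ∀ {m} x δ (v : Vec ℕ m) →
  T (compatibleWithAll x δ (toList v)) ⇔ (∀ j → T (compatible x (δ + toℕ j) (lookup v j)))
compatibleWithAll⇔lookup x δ []ᵛ       = mk⇔ (λ _ ()) (λ _ → _)
compatibleWithAll⇔lookup x δ (y ∷ᵛ v) = mk⇔ to from
  where
  rest = compatibleWithAll⇔lookup x (suc δ) v
  to : T (compatibleWithAll x δ (y ∷ toList v)) → ∀ j → T (compatible x (δ + toℕ j) (lookup (y ∷ᵛ v) j))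
  to t Fin.zero    = subst (λ d → T (compatible x d y)) (sym (+-identityʳ δ)) (proj₁ (Equivalence.to T-∧ t))
  to t (Fin.suc j) = subst (λ d → T (compatible x d (lookup v j))) (sym (+-suc δ (toℕ j)))
                           (Equivalence.to rest (proj₂ (Equivalence.to T-∧ t)) j)
  from : (∀ j → T (compatible x (δ + toℕ j) (lookup (y ∷ᵛ v) j))) → T (compatibleWithAll x δ (y ∷ toList v))
  from h = Equivalence.from T-∧
    ( subst (λ d → T (compatible x d y)) (+-identityʳ δ) (h Fin.zero)
    , Equivalence.from rest (λ j → subst (λ d → T (compatible x d (lookup v j))) (+-suc δ (toℕ j)) (h (Fin.suc j))))

validList⇔AllCompatible : ∀ {m} (v : Vec ℕ m) → T (validList (toList v)) ⇔ AllCompatible v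
validList⇔AllCompatible []ᵛ       = mk⇔ (λ _ ()) (λ _ → _)
validList⇔AllCompatible (x ∷ᵛ v) = mk⇔ to from
  where
  rest = validList⇔AllCompatible v
  to : T (validList (x ∷ toList v)) → AllCompatible (x ∷ᵛ v)
  to t Fin.zero    (Fin.suc j) _   = Equivalence.to (compatibleWithAll⇔lookup x 1 v) (proj₁ (Equivalence.to T-∧ t)) j
  to t (Fin.suc i) (Fin.suc j) i<j = Equivalence.to rest (proj₂ (Equivalence.to T-∧ t)) i j (s≤s⁻¹ i<j)
  from : AllCompatible (x ∷ᵛ v) → T (validList (x ∷ toList v))
  from h = Equivalence.from T-∧
    ( Equivalence.from (compatibleWithAll⇔lookup x 1 v) (λ j → h Fin.zero (Fin.suc j) z<s)
    , Equivalence.from rest (λ i j i<j → h (Fin.suc i) (Fin.suc j) (s≤s i<j)))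

does-valid? : ∀ {m} (v : Vec ℕ m) → does (valid? v) ≡ validList (toList v)
does-valid? v = does-⇔ (mk⇔
  (λ valid → Equivalence.from (validList⇔AllCompatible v) (Equivalence.to (Valid⇔AllCompatible v) valid))
  (λ t → Equivalence.from (Valid⇔AllCompatible v) (Equivalence.to (validList⇔AllCompatible v) t)))
  (valid? v) (T? (validList (toList v)))

∑list : ∀ {A : Set} → (A → ℕ) → List A → ℕ
∑list f []       = 0
∑list f (x ∷ xs) = f x + ∑list f xs

∑list-cong : ∀ {A : Set} {f g : A → ℕ} xs → (∀ x → f x ≡ g x) → ∑list f xs ≡ ∑list g xs
∑list-cong []       f≗g = refl
∑list-cong (x ∷ xs) f≗g = cong₂ _+_ (f≗g x) (∑list-cong xs f≗g)

∑list-++ : ∀ {A : Set} (f : A → ℕ) xs ys → ∑list f (xs ++ ys) ≡ ∑list f xs + ∑list f ys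
∑list-++ f []       ys = refl
∑list-++ f (x ∷ xs) ys = trans (cong (λ t → f x + t) (∑list-++ f xs ys)) (sym (+-assoc (f x) _ _))

∑list-concatMap : ∀ {A B : Set} (f : B → ℕ) (g : A → List B) xs →
  ∑list f (concatMap g xs) ≡ ∑list (λ x → ∑list f (g x)) xs
∑list-concatMap f g []       = refl
∑list-concatMap f g (x ∷ xs) =
  trans (∑list-++ f (g x) (concatMap g xs)) (cong (λ t → ∑list f (g x) + t) (∑list-concatMap f g xs))

∑list-map : ∀ {A B : Set} (f : B → ℕ) (h : A → B) xs → ∑list f (map h xs) ≡ ∑list (λ x → f (h x)) xs
∑list-map f h []       = refl
∑list-map f h (x ∷ xs) = cong (λ t → f (h x) + t) (∑list-map f h xs)

∑list-applyUpTo : ∀ (f g : ℕ → ℕ) n → ∑list f (applyUpTo g n) ≡ ∑[ i < n ] f (g i)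
∑list-applyUpTo f g zero    = refl
∑list-applyUpTo f g (suc n) = cong (λ t → f (g 0) + t) (∑list-applyUpTo f (λ i → g (suc i)) n)

length-filter≡∑list : ∀ {A : Set} {P : A → Set} (P? : ∀ x → Dec (P x)) xs →
  length (filter P? xs) ≡ ∑list (λ x → 𝟙 (does (P? x))) xs
length-filter≡∑list P? []       = refl
length-filter≡∑list P? (x ∷ xs) with does (P? x)
... | true  = cong suc (length-filter≡∑list P? xs)
... | false = length-filter≡∑list P? xs

∑list-boundedSeqs : ∀ n m (g : List ℕ → ℕ) → ∑list (λ v → g (toList v)) (boundedSeqs n m) ≡ ∑box (replicate m n) g
∑list-boundedSeqs n zero    g = +-identityʳ (g [])
∑list-boundedSeqs n (suc m) g = begin
  ∑list (λ v → g (toList v)) (concatMap (λ x → map (x ∷ᵛ_) (boundedSeqs n m)) (applyUpTo suc n))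
    ≡⟨ ∑list-concatMap _ _ (applyUpTo suc n) ⟩
  ∑list (λ x → ∑list (λ v → g (toList v)) (map (x ∷ᵛ_) (boundedSeqs n m))) (applyUpTo suc n)
    ≡⟨ ∑list-applyUpTo _ suc n ⟩
  ∑[ x < n ] ∑list (λ v → g (toList v)) (map (suc x ∷ᵛ_) (boundedSeqs n m))
    ≡⟨ ∑-cong n (λ x _ → trans (∑list-map _ (suc x ∷ᵛ_) (boundedSeqs n m))
                              (∑list-boundedSeqs n m (λ u → g (suc x ∷ u)))) ⟩
  ∑[ x < n ] ∑box (replicate m n) (λ u → g (suc x ∷ u)) ∎

countValid≡squareCount : ∀ n m → countValid n m ≡ squareCount n m
countValid≡squareCount n m = begin
  length (filter valid? (boundedSeqs n m))
    ≡⟨ length-filter≡∑list valid? (boundedSeqs n m) ⟩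
  ∑list (λ v → 𝟙 (does (valid? v))) (boundedSeqs n m)
    ≡⟨ ∑list-cong (boundedSeqs n m) (λ v → cong 𝟙 (does-valid? v)) ⟩
  ∑list (λ v → 𝟙 (validList (toList v))) (boundedSeqs n m)
    ≡⟨ ∑list-boundedSeqs n m (λ u → 𝟙 (validList u)) ⟩
  squareCount n m ∎

-- The Catalan transform

toℚ : ℕ → ℚ
toℚ a = + a / 1

toℚ≡mkℚ : ∀ a → toℚ a ≡ mkℚ (+ a) 0 (coprime-sym (1-coprimeTo a))
toℚ≡mkℚ a = ℚ.normalize-coprime {a} {0} (coprime-sym (1-coprimeTo a))

toℚ-homo-+ : ∀ a b → toℚ a ℚ.+ toℚ b ≡ toℚ (a + b)
toℚ-homo-+ a b rewrite toℚ≡mkℚ a | toℚ≡mkℚ b =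
  ℚ./-cong {+ a ℤ.* + 1 ℤ.+ + b ℤ.* + 1} {1} {+ (a + b)} {1}
           (cong₂ ℤ._+_ (ℤ.*-identityʳ (+ a)) (ℤ.*-identityʳ (+ b))) refl

toℚ-homo-* : ∀ a b → toℚ a ℚ.* toℚ b ≡ toℚ (a * b)
toℚ-homo-* a b rewrite toℚ≡mkℚ a | toℚ≡mkℚ b =
  ℚ./-cong {+ a ℤ.* + b} {1} {+ (a * b)} {1} (sym (ℤ.pos-* a b)) refl

[t*n]/n≡toℚ-t : ∀ t d → + (t * suc d) / suc d ≡ toℚ t
[t*n]/n≡toℚ-t t d = ℚ.fromℚᵘ-cong {mkℚᵘ (+ (t * suc d)) d} {mkℚᵘ (+ t) 0}
  (*≡* (trans (ℤ.*-identityʳ (+ (t * suc d))) (ℤ.pos-* t (suc d))))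

shiftedCatalanℕ : ℕ → ℕ → ℕ
shiftedCatalanℕ k j = if k ≤ᵇ j then catalanℕ (j ∸ k) else 0

shiftedCatalan≡toℚ : ∀ k j → shiftedCatalan k j ≡ toℚ (shiftedCatalanℕ k j)
shiftedCatalan≡toℚ k j with k ≤ᵇ j
... | true  = trans (cong (λ c → + c / suc (j ∸ k)) (catalanℕ-closed (j ∸ k)))
                    ([t*n]/n≡toℚ-t (catalanℕ (j ∸ k)) (j ∸ k))
... | false = refl

transformCoeff≡ballot : ∀ n j → j ≤ n → transformCoeff n j ≡ toℚ (ballot n (n ∸ j))
transformCoeff≡ballot zero    zero z≤n = refl
transformCoeff≡ballot n@(suc _) j    j≤n with 2 * n ∸ j in eq
... | zero  = contradiction (≤-trans (m∸n≡0⇒m≤n eq) j≤n) (<⇒≱ (m<m+n n z<s))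
... | suc d = begin
  + (j * (suc d C r)) / suc d      ≡⟨ cong (λ t → + t / suc d) j*C≡ballot*[1+d] ⟩
  + (ballot n r * suc d) / suc d   ≡⟨ [t*n]/n≡toℚ-t (ballot n r) d ⟩
  toℚ (ballot n r)                 ∎
  where
  r = n ∸ j
  n+r≡1+d : n + r ≡ suc d
  n+r≡1+d = trans (sym (+-∸-assoc n j≤n)) (trans (cong (λ t → (n + t) ∸ j) (sym (+-identityʳ n))) eq)
  j*C≡ballot*[1+d] : j * (suc d C r) ≡ ballot n r * suc d
  j*C≡ballot*[1+d] = sym (begin
    ballot n r * suc d          ≡⟨ cong (ballot n r *_) (sym n+r≡1+d) ⟩
    ballot n r * (n + r)        ≡⟨ ballot-closed n r (m∸n≤m n j) ⟩
    (n ∸ r) * ((n + r) C r)     ≡⟨ cong₂ (λ a b → a * (b C r)) (m∸[m∸n]≡n j≤n) n+r≡1+d ⟩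
    j * (suc d C r)             ∎)

foldr-+-applyUpTo-toℚ : ∀ N (f : ℕ → ℕ) (h : ℕ → ℚ) (g : ℕ → ℕ) → (∀ i → i < N → h (f i) ≡ toℚ (g i)) →
  foldr ℚ._+_ 0ℚ (map h (applyUpTo f N)) ≡ toℚ (∑ N g)
foldr-+-applyUpTo-toℚ zero    f h g h≗g = refl
foldr-+-applyUpTo-toℚ (suc N) f h g h≗g = begin
  h (f 0) ℚ.+ foldr ℚ._+_ 0ℚ (map h (applyUpTo (λ i → f (suc i)) N))
    ≡⟨ cong₂ ℚ._+_ (h≗g 0 z<s) (foldr-+-applyUpTo-toℚ N (λ i → f (suc i)) h (λ i → g (suc i))
                                                   (λ i i<N → h≗g (suc i) (s≤s i<N))) ⟩
  toℚ (g 0) ℚ.+ toℚ (∑[ i < N ] g (suc i))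
    ≡⟨ toℚ-homo-+ (g 0) _ ⟩
  toℚ (∑ (suc N) g) ∎

catalanTransform-shiftedCatalan : ∀ k n →
  catalanTransform (shiftedCatalan k) n ≡ toℚ (∑[ j < suc n ] (ballot n (n ∸ j) * shiftedCatalanℕ k j))
catalanTransform-shiftedCatalan k n =
  foldr-+-applyUpTo-toℚ (suc n) (λ j → j) _ (λ j → ballot n (n ∸ j) * shiftedCatalanℕ k j) λ j j<1+n → begin
    transformCoeff n j ℚ.* shiftedCatalan k j
      ≡⟨ cong₂ ℚ._*_ (transformCoeff≡ballot n j (s≤s⁻¹ j<1+n)) (shiftedCatalan≡toℚ k j) ⟩
    toℚ (ballot n (n ∸ j)) ℚ.* toℚ (shiftedCatalanℕ k j)
      ≡⟨ toℚ-homo-* (ballot n (n ∸ j)) (shiftedCatalanℕ k j) ⟩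
    toℚ (ballot n (n ∸ j) * shiftedCatalanℕ k j) ∎

shiftedCatalanℕ-below : ∀ {k j} → j < k → shiftedCatalanℕ k j ≡ 0
shiftedCatalanℕ-below {k} {j} j<k = cong (λ b → if b then catalanℕ (j ∸ k) else 0) (>⇒≤ᵇ≡false j<k)

shiftedCatalanℕ-above : ∀ {k j} → k ≤ j → shiftedCatalanℕ k j ≡ catalanℕ (j ∸ k)
shiftedCatalanℕ-above {k} {j} k≤j = cong (λ b → if b then catalanℕ (j ∸ k) else 0) (≤⇒≤ᵇ≡true k≤j)

∑-ballot-shiftedCatalan-below : ∀ k n → n < k → ∑[ j < suc n ] (ballot n (n ∸ j) * shiftedCatalanℕ k j) ≡ 0
∑-ballot-shiftedCatalan-below k n n<k = ∑-zero (suc n) _ λ j j≤n →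
  trans (cong (ballot n (n ∸ j) *_) (shiftedCatalanℕ-below (≤-<-trans (s≤s⁻¹ j≤n) n<k)))
        (*-zeroʳ (ballot n (n ∸ j)))

∑-ballot-shiftedCatalan : ∀ k n → k ≤ n →
  ∑[ j < suc n ] (ballot n (n ∸ j) * shiftedCatalanℕ k j) ≡ ballotConvolution n (n ∸ k)
∑-ballot-shiftedCatalan k n k≤n = begin
  ∑ (suc n) term                    ≡⟨ ∑-reverse (suc n) term ⟩
  ∑[ r < suc n ] term (n ∸ r)       ≡⟨ ∑-truncate (suc m) (suc n) _ (s≤s (m∸n≤m n k)) vanishes ⟩
  ∑[ r < suc m ] term (n ∸ r)       ≡⟨ ∑-cong (suc m) reindex ⟩
  ballotConvolution n m             ∎
  where
  m = n ∸ k
  term : ℕ → ℕ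
  term j = ballot n (n ∸ j) * shiftedCatalanℕ k j
  vanishes : ∀ r → suc m ≤ r → r < suc n → term (n ∸ r) ≡ 0
  vanishes r m<r r≤n = trans (cong (ballot n (n ∸ (n ∸ r)) *_) (shiftedCatalanℕ-below n∸r<k))
                             (*-zeroʳ (ballot n (n ∸ (n ∸ r))))
    where
    n∸r<k : n ∸ r < k
    n∸r<k = subst (n ∸ r <_) (m∸[m∸n]≡n k≤n) (∸-monoʳ-< m<r (s≤s⁻¹ r≤n))
  reindex : ∀ r → r < suc m → term (n ∸ r) ≡ ballot n r * catalanℕ (m ∸ r)
  reindex r r<1+m = cong₂ _*_ (cong (ballot n) (m∸[m∸n]≡n r≤n))
                              (trans (shiftedCatalanℕ-above k≤n∸r) (cong catalanℕ n∸r∸k≡m∸r))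
    where
    r≤m = s≤s⁻¹ r<1+m
    r≤n = ≤-trans r≤m (m∸n≤m n k)
    k≤n∸r : k ≤ n ∸ r
    k≤n∸r = m+n≤o⇒m≤o∸n k (subst (_≤ n) (+-comm r k) (subst (r + k ≤_) (m∸n+n≡m k≤n) (+-monoˡ-≤ k r≤m)))
    n∸r∸k≡m∸r : n ∸ r ∸ k ≡ m ∸ r
    n∸r∸k≡m∸r = trans (∸-+-assoc n r k) (trans (cong (n ∸_) (+-comm r k)) (sym (∸-+-assoc n k r)))

catalanTransform≡ballotConvolution : ∀ k n → k ≤ n →
  catalanTransform (shiftedCatalan k) n ≡ toℚ (ballotConvolution n (n ∸ k))
catalanTransform≡ballotConvolution k n k≤n =
  trans (catalanTransform-shiftedCatalan k n) (cong toℚ (∑-ballot-shiftedCatalan k n k≤n))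

theorem7 : (k : ℕ) →
    ((n : ℕ) → n < k → catalanTransform (shiftedCatalan k) n ≡ 0ℚ)
    × (catalanTransform (shiftedCatalan k) k ≡ 1ℚ)
    × ((n : ℕ) → suc k ≤ n →
        catalanTransform (shiftedCatalan k) n ≡ (+ countValid n (n ∸ k)) / 1)
theorem7 k = vanishing , atShift , counting
  where
  vanishing : ∀ n → n < k → catalanTransform (shiftedCatalan k) n ≡ 0ℚ
  vanishing n n<k = trans (catalanTransform-shiftedCatalan k n) (cong toℚ (∑-ballot-shiftedCatalan-below k n n<k))
  atShift : catalanTransform (shiftedCatalan k) k ≡ 1ℚ
  atShift = trans (catalanTransform≡ballotConvolution k k ≤-refl) (cong (λ m → toℚ (ballotConvolution k m)) (n∸n≡0 k))
  counting : ∀ n → suc k ≤ n → catalanTransform (shiftedCatalan k) n ≡ toℚ (countValid n (n ∸ k))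
  counting n k<n = begin
    catalanTransform (shiftedCatalan k) n
      ≡⟨ catalanTransform≡ballotConvolution k n (<⇒≤ k<n) ⟩
    toℚ (ballotConvolution n (n ∸ k))
      ≡⟨ cong toℚ (sym (squareCount≡ballotConvolution n (n ∸ k) (m∸n≤m n k))) ⟩
    toℚ (squareCount n (n ∸ k))
      ≡⟨ cong toℚ (sym (countValid≡squareCount n (n ∸ k))) ⟩
    toℚ (countValid n (n ∸ k)) ∎
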